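{- For $b\ge 0$ let $a_b$ denote the sum of all entries of the matrix $A_b$ (the number of cards for multiplex juggling with $b$ balls). Then for all $b\ge 3$, \[ a_b=4a_{b-1}-2a_{b-2}. \]
   Context: An ordered partition (composition) of a positive integer $b$ is a finite sequence $(q_1,\ldots,q_k)$ of positive integers with sum $b$. For ordered partitions $q=(q_1,\ldots,q_k)$ and $r=(r_1,\ldots,r_\ell)$ of $b$, a nontrivial embedding of $q$ into $r$ is a choice of indices $1\le i_2<\cdots<i_k\le \ell$ with $q_j\le r_{i_j}$ for $2\le j\le k$ (when $k=1$ there is exactly one, the empty choice); $q$ has one trivial embedding into $r$ if $q=r$ and none otherwise. For $b\ge1$, $A_b$ is the matrix indexed by ordered partitions of $b$ whose $(q,r)$ entry is the number of nontrivial embeddings of $q$ into $r$ plus $1$ if $q=r$. By convention $A_0=(1)$ (a $1\times 1$ matrix indexed by the empty partition). -}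

module Defs where

open import Data.Nat using (ℕ; zero; suc; _+_; _∸_; _≤?_)
open import Data.Nat.Properties using (_≟_)
open import Data.List using (List; []; _∷_; map; concatMap; upTo)
open import Data.Nat.ListAction using (sum)
open import Data.List.Properties using (≡-dec)
open import Relation.Nullary using (yes; no)

-- An ordered partition (composition) is a list of positive naturals.
-- compositionsFuel f n : all compositions of n, provided f ≥ n
-- (first part k ranges over 1..n, followed by a composition of n ∸ k).
compositionsFuel : ℕ → ℕ → List (List ℕ)
compositionsFuel _       zero    = [] ∷ []
compositionsFuel zero    (suc n) = []
compositionsFuel (suc f) (suc n) =
  concatMap (λ i → map (suc i ∷_) (compositionsFuel f (n ∸ i))) (upTo (suc n))

compositions : ℕ → List (List ℕ)
compositions b = compositionsFuel b b

subEmb : List ℕ → List ℕ → ℕ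
subEmb []       _        = 1
subEmb (_ ∷ _)  []       = 0
subEmb (x ∷ xs) (y ∷ ys) with x ≤? y
... | yes _ = subEmb xs ys + subEmb (x ∷ xs) ys
... | no  _ = subEmb (x ∷ xs) ys

-- Number of nontrivial embeddings of q = (q_1,...,q_k) into r:
-- choices 1 ≤ i_2 < ... < i_k ≤ ℓ with q_j ≤ r_{i_j} for 2 ≤ j ≤ k.
nontrivialEmb : List ℕ → List ℕ → ℕ
nontrivialEmb []       r = 0   -- not used for b ≥ 1 (partitions are nonempty)
nontrivialEmb (_ ∷ qs) r = subEmb qs r

trivialEmb : List ℕ → List ℕ → ℕ
trivialEmb q r with ≡-dec _≟_ q r
... | yes _ = 1
... | no  _ = 0

entryA : List ℕ → List ℕ → ℕ
entryA q r = nontrivialEmb q r + trivialEmb q r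

-- a_b : sum of all entries of A_b, with A_0 = (1) by convention.
a : ℕ → ℕ
a zero = 1
a (suc b) = sum (concatMap (λ q → map (entryA q) (compositions (suc b)))
                           (compositions (suc b)))

-- Sum A_b column by column.  In column r ⊨ b the trivial embeddings contribute 1.  A nontrivial
-- embedding of q = (q₁, q′) into r places the parts of q′ at increasing positions of r, each at
-- most the entry there; recording the parts at their positions and 0 elsewhere identifies these
-- embeddings, for q′ ⊨ m, with the vectors 0 ≤ s ≤ r of sum m, which are counted by the
-- coefficient of xᵐ in ∏ᵢ (1 + x + ⋯ + x^rᵢ).  As q₁ runs over 1, …, b, m runs over every degree
-- below the top one, whose coefficient is 1, so the column sums to ∏ᵢ (1 + rᵢ).  Hence
-- a_b = ∑_{r ⊨ b} ∏ᵢ (1 + rᵢ); splitting off r₁ = i + 1 gives a_{n+1} = ∑_{i ≤ n} (i + 2) a_{n−i},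
-- a convolution whose generating function (1 − x)²/(1 − 4x + 2x²) yields the recurrence.

module Submission where

open import Defs
import Algebra.Properties.CommutativeMonoid.Sum as CommutativeMonoidSum
open import Algebra.Properties.CommutativeSemigroup using (interchange)
open import Data.Bool using (true; false; if_then_else_)
open import Data.Empty using (⊥-elim)
open import Data.Fin using (Fin; toℕ)
open import Data.Fin.Properties using (toℕ<n; toℕ-fromℕ; toℕ-inject₁)
open import Data.List using (List; []; _∷_; map; concatMap; applyUpTo; upTo)
open import Data.List.Properties
  using (map-∘; map-cong; map-cong-local; map-concatMap; concatMap-cong; ≡-dec; ∷-injective)
open import Data.List.Relation.Unary.All using (All; []; _∷_)
import Data.List.Relation.Unary.All as All
open import Data.List.Relation.Unary.All.Properties using (concat⁺; map⁺; applyUpTo⁺₁)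
open import Data.Nat
  using (ℕ; zero; suc; _+_; _*_; _∸_; _≤_; _<_; _≥_; _<ᵇ_; _⊓_; _≤?_; z≤n; s≤s; s≤s⁻¹)
open import Data.Nat.ListAction using (sum; product)
open import Data.Nat.ListAction.Properties using (sum-++)
open import Data.Nat.Properties
open import Data.Nat.Tactic.RingSolver using (solve-∀)
open import Data.Product using (proj₁; proj₂)
open import Function using (_∘_)
open import Relation.Binary.PropositionalEquality
open import Relation.Nullary using (¬_; Dec; yes; no)

open ≡-Reasoning

private
  module ∑Fin = CommutativeMonoidSum +-0-commutativeMonoid

∑< : ℕ → (ℕ → ℕ) → ℕ
∑< n h = ∑Fin.sum (λ (i : Fin n) → h (toℕ i))

syntax ∑< n (λ i → e) = ∑[ i < n ] e

∑<-cong : ∀ n {g h : ℕ → ℕ} → (∀ i → i < n → g i ≡ h i) → ∑< n g ≡ ∑< n h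
∑<-cong n g≡h = ∑Fin.sum-cong-≗ (λ i → g≡h (toℕ i) (toℕ<n i))

∑<-distrib-+ : ∀ n (g h : ℕ → ℕ) → ∑[ i < n ] (g i + h i) ≡ ∑< n g + ∑< n h
∑<-distrib-+ n g h = ∑Fin.∑-distrib-+ {n} (g ∘ toℕ) (h ∘ toℕ)

∑<-comm : ∀ m n (h : ℕ → ℕ → ℕ) →
          ∑[ i < m ] ∑[ j < n ] h i j ≡ ∑[ j < n ] ∑[ i < m ] h i j
∑<-comm m n h = ∑Fin.∑-comm {m} {n} (λ i j → h (toℕ i) (toℕ j))

∑<-last : ∀ n (h : ℕ → ℕ) → ∑< (suc n) h ≡ ∑< n h + h n
∑<-last n h = trans (∑Fin.sum-init-last {n} (h ∘ toℕ))
  (cong₂ _+_ (∑Fin.sum-cong-≗ {n} (cong h ∘ toℕ-inject₁)) (cong h (toℕ-fromℕ n)))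

∑<-zero : ∀ n {h : ℕ → ℕ} → (∀ i → i < n → h i ≡ 0) → ∑< n h ≡ 0
∑<-zero n h≡0 = trans (∑<-cong n h≡0) (∑Fin.sum-replicate-zero n)

∑<-const : ∀ n k → ∑[ _ < n ] k ≡ n * k
∑<-const zero    k = refl
∑<-const (suc n) k = cong (k +_) (∑<-const n k)

∑<-reverse : ∀ n (h : ℕ → ℕ) → ∑[ i < suc n ] h (n ∸ i) ≡ ∑< (suc n) h
∑<-reverse zero    h = refl
∑<-reverse (suc n) h = begin
  h (suc n) + ∑[ i < suc n ] h (n ∸ i) ≡⟨ cong (h (suc n) +_) (∑<-reverse n h) ⟩
  h (suc n) + ∑< (suc n) h             ≡⟨ +-comm (h (suc n)) _ ⟩
  ∑< (suc n) h + h (suc n)             ≡⟨ ∑<-last (suc n) h ⟨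
  ∑< (suc (suc n)) h                   ∎

∑<-delta : ∀ n j {h : ℕ → ℕ} → j < n → (∀ i → i ≢ j → h i ≡ 0) → ∑< n h ≡ h j
∑<-delta (suc n) zero    {h} _         h≡0 =
  trans (cong (h 0 +_) (∑<-zero n (λ i _ → h≡0 (suc i) (λ ())))) (+-identityʳ (h 0))
∑<-delta (suc n) (suc j) {h} (s≤s j<n) h≡0 =
  trans (cong (_+ ∑[ i < n ] h (suc i)) (h≡0 0 (λ ())))
        (∑<-delta n j j<n (λ i i≢j → h≡0 (suc i) (i≢j ∘ suc-injective)))

if-<ᵇ-true : ∀ {i m} x → i < m → (if i <ᵇ m then x else 0) ≡ x
if-<ᵇ-true {zero}  {suc m} x _         = refl
if-<ᵇ-true {suc i} {suc m} x (s≤s i<m) = if-<ᵇ-true x i<m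

if-<ᵇ-false : ∀ {i m} x → ¬ i < m → (if i <ᵇ m then x else 0) ≡ 0
if-<ᵇ-false {i}     {zero}  x _   = refl
if-<ᵇ-false {zero}  {suc m} x i≮m = ⊥-elim (i≮m (s≤s z≤n))
if-<ᵇ-false {suc i} {suc m} x i≮m = if-<ᵇ-false x (i≮m ∘ s≤s)

∑<-if-<ᵇ : ∀ a b (h : ℕ → ℕ) → ∑[ i < a ] (if i <ᵇ b then h i else 0) ≡ ∑< (a ⊓ b) h
∑<-if-<ᵇ zero    b       h = refl
∑<-if-<ᵇ (suc a) zero    h = ∑<-zero (suc a) (λ _ _ → refl)
∑<-if-<ᵇ (suc a) (suc b) h = cong (h 0 +_) (∑<-if-<ᵇ a b (h ∘ suc))

∑<-if-<ᵇ-comm : ∀ a b (h : ℕ → ℕ) →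
  ∑[ i < a ] (if i <ᵇ b then h i else 0) ≡ ∑[ i < b ] (if i <ᵇ a then h i else 0)
∑<-if-<ᵇ-comm a b h = begin
  ∑[ i < a ] (if i <ᵇ b then h i else 0) ≡⟨ ∑<-if-<ᵇ a b h ⟩
  ∑< (a ⊓ b) h                           ≡⟨ cong (λ k → ∑< k h) (⊓-comm a b) ⟩
  ∑< (b ⊓ a) h                           ≡⟨ ∑<-if-<ᵇ b a h ⟨
  ∑[ i < b ] (if i <ᵇ a then h i else 0) ∎

∑<-shift : ∀ M j (h : ℕ → ℕ) →
           ∑[ m < M ] (if j <ᵇ suc m then h (m ∸ j) else 0) ≡ ∑< (M ∸ j) h
∑<-shift M       zero    h = refl
∑<-shift zero    (suc j) h = refl
∑<-shift (suc M) (suc j) h = ∑<-shift M j h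

private variable A B : Set

∑∈ : (A → ℕ) → List A → ℕ
∑∈ f xs = sum (map f xs)

syntax ∑∈ (λ x → e) xs = ∑[ x ∈ xs ] e

∑∈-zero : (xs : List A) → ∑[ _ ∈ xs ] 0 ≡ 0
∑∈-zero []       = refl
∑∈-zero (_ ∷ xs) = ∑∈-zero xs

sum-concatMap : ∀ (g : A → List ℕ) xs → sum (concatMap g xs) ≡ ∑[ x ∈ xs ] sum (g x)
sum-concatMap g []       = refl
sum-concatMap g (x ∷ xs) =
  trans (sum-++ (g x) (concatMap g xs)) (cong (sum (g x) +_) (sum-concatMap g xs))

∑∈-concatMap : ∀ (f : B → ℕ) (g : A → List B) xs →
               ∑∈ f (concatMap g xs) ≡ ∑[ x ∈ xs ] ∑∈ f (g x)
∑∈-concatMap f g xs = trans (cong sum (map-concatMap f g xs)) (sum-concatMap (map f ∘ g) xs)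

∑∈-map : ∀ (f : B → ℕ) (g : A → B) xs → ∑∈ f (map g xs) ≡ ∑∈ (f ∘ g) xs
∑∈-map f g xs = cong sum (sym (map-∘ xs))

∑∈-applyUpTo : ∀ (f k : ℕ → ℕ) n → ∑∈ f (applyUpTo k n) ≡ ∑[ i < n ] f (k i)
∑∈-applyUpTo f k zero    = refl
∑∈-applyUpTo f k (suc n) = cong (f (k 0) +_) (∑∈-applyUpTo f (k ∘ suc) n)

∑∈-cong : ∀ {f g : A → ℕ} xs → (∀ x → f x ≡ g x) → ∑∈ f xs ≡ ∑∈ g xs
∑∈-cong xs f≗g = cong sum (map-cong f≗g xs)

∑∈-cong-All : ∀ {f g : A → ℕ} {xs} → All (λ x → f x ≡ g x) xs → ∑∈ f xs ≡ ∑∈ g xs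
∑∈-cong-All f≡g = cong sum (map-cong-local f≡g)

∑∈-distrib-+ : ∀ (f g : A → ℕ) xs → ∑[ x ∈ xs ] (f x + g x) ≡ ∑∈ f xs + ∑∈ g xs
∑∈-distrib-+ f g []       = refl
∑∈-distrib-+ f g (x ∷ xs) = trans (cong (f x + g x +_) (∑∈-distrib-+ f g xs))
  (interchange +-commutativeSemigroup (f x) (g x) (∑∈ f xs) (∑∈ g xs))

∑∈-*ˡ : ∀ k (f : A → ℕ) xs → ∑[ x ∈ xs ] (k * f x) ≡ k * ∑∈ f xs
∑∈-*ˡ k f []       = sym (*-zeroʳ k)
∑∈-*ˡ k f (x ∷ xs) =
  trans (cong (k * f x +_) (∑∈-*ˡ k f xs)) (sym (*-distribˡ-+ k (f x) (∑∈ f xs)))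

∑∈-if : ∀ b (f : A → ℕ) xs → ∑[ x ∈ xs ] (if b then f x else 0) ≡ (if b then ∑∈ f xs else 0)
∑∈-if true  f xs = refl
∑∈-if false f xs = ∑∈-zero xs

∑∈-comm : ∀ (h : A → B → ℕ) xs ys →
          ∑[ x ∈ xs ] ∑[ y ∈ ys ] h x y ≡ ∑[ y ∈ ys ] ∑[ x ∈ xs ] h x y
∑∈-comm h []       ys = sym (∑∈-zero ys)
∑∈-comm h (x ∷ xs) ys = trans (cong (∑∈ (h x) ys +_) (∑∈-comm h xs ys))
  (sym (∑∈-distrib-+ (h x) (λ y → ∑[ x′ ∈ xs ] h x′ y) ys))

compositionsFuel-irrelevant : ∀ {f g} n → n ≤ f → n ≤ g →
                              compositionsFuel f n ≡ compositionsFuel g n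
compositionsFuel-irrelevant zero    _         _         = refl
compositionsFuel-irrelevant (suc n) (s≤s n≤f) (s≤s n≤g) = concatMap-cong
  (λ i → cong (map (suc i ∷_)) (compositionsFuel-irrelevant (n ∸ i)
    (≤-trans (m∸n≤m n i) n≤f) (≤-trans (m∸n≤m n i) n≤g)))
  (upTo (suc n))

∑-compositionsFuel-suc : ∀ f n (h : List ℕ → ℕ) →
  ∑∈ h (compositionsFuel (suc f) (suc n))
    ≡ ∑[ i < suc n ] ∑[ xs ∈ compositionsFuel f (n ∸ i) ] h (suc i ∷ xs)
∑-compositionsFuel-suc f n h = begin
  ∑∈ h (concatMap block (upTo (suc n)))
    ≡⟨ ∑∈-concatMap h block (upTo (suc n)) ⟩
  ∑[ i ∈ upTo (suc n) ] ∑∈ h (block i)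
    ≡⟨ ∑∈-applyUpTo (∑∈ h ∘ block) (λ i → i) (suc n) ⟩
  ∑[ i < suc n ] ∑∈ h (block i)
    ≡⟨ ∑<-cong (suc n) (λ i _ → ∑∈-map h (suc i ∷_) (rest i)) ⟩
  ∑[ i < suc n ] ∑[ xs ∈ rest i ] h (suc i ∷ xs) ∎
  where
  rest : ℕ → List (List ℕ)
  rest i = compositionsFuel f (n ∸ i)
  block : ℕ → List (List ℕ)
  block i = map (suc i ∷_) (rest i)

∑-compositions-suc : ∀ n (h : List ℕ → ℕ) →
  ∑∈ h (compositions (suc n)) ≡ ∑[ i < suc n ] ∑[ xs ∈ compositions (n ∸ i) ] h (suc i ∷ xs)
∑-compositions-suc n h = trans (∑-compositionsFuel-suc n n h) (∑<-cong (suc n) (λ i _ →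
  cong (∑∈ (h ∘ (suc i ∷_))) (compositionsFuel-irrelevant (n ∸ i) (m∸n≤m n i) ≤-refl)))

All-compositionsFuel-suc : ∀ f n {P : List ℕ → Set} →
  (∀ i → i ≤ n → All (λ xs → P (suc i ∷ xs)) (compositionsFuel f (n ∸ i))) →
  All P (compositionsFuel (suc f) (suc n))
All-compositionsFuel-suc f n P-rest = concat⁺ (map⁺ (applyUpTo⁺₁ (λ i → i) (suc n)
  (λ {i} i<1+n → map⁺ (P-rest i (s≤s⁻¹ i<1+n)))))

compositionsFuel-sum : ∀ f n → All (λ r → sum r ≡ n) (compositionsFuel f n)
compositionsFuel-sum f       zero    = refl ∷ []
compositionsFuel-sum zero    (suc n) = []
compositionsFuel-sum (suc f) (suc n) = All-compositionsFuel-suc f n (λ i i≤n →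
  All.map (λ sum≡ → cong suc (trans (cong (i +_) sum≡) (m+[n∸m]≡n i≤n)))
          (compositionsFuel-sum f (n ∸ i)))

-- Coefficients of ∏ᵢ (1 + x + ⋯ + x^rᵢ)

-- coeff m r is the number of vectors s with 0 ≤ sᵢ ≤ rᵢ and ∑ᵢ sᵢ = m.
coeff : ℕ → List ℕ → ℕ
coeff m []       = if m <ᵇ 1 then 1 else 0
coeff m (y ∷ ys) = ∑[ j < suc y ] (if j <ᵇ suc m then coeff (m ∸ j) ys else 0)

coeff-0 : ∀ r → coeff 0 r ≡ 1
coeff-0 []       = refl
coeff-0 (y ∷ ys) = cong₂ _+_ (coeff-0 ys) (∑<-zero y (λ _ _ → refl))

m+n<o⇒n<o∸m : ∀ m n o → m + n < o → n < o ∸ m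
m+n<o⇒n<o∸m m n o m+n<o = m+n≤o⇒m≤o∸n (suc n) (subst (_≤ o) (cong suc (+-comm m n)) m+n<o)

coeff-above-degree : ∀ r m → sum r < m → coeff m r ≡ 0
coeff-above-degree []       (suc m) _     = refl
coeff-above-degree (y ∷ ys) m       y+s<m = ∑<-zero (suc y) (λ j j≤y →
  let j+s<m = ≤-<-trans (+-monoˡ-≤ (sum ys) (s≤s⁻¹ j≤y)) y+s<m in
  trans (if-<ᵇ-true _ (s≤s (<⇒≤ (≤-<-trans (m≤m+n j (sum ys)) j+s<m))))
        (coeff-above-degree ys (m ∸ j) (m+n<o⇒n<o∸m j (sum ys) m j+s<m)))

coeff-at-degree : ∀ r → coeff (sum r) r ≡ 1
coeff-at-degree []       = refl
coeff-at-degree (y ∷ ys) = begin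
  ∑[ j < suc y ] term j      ≡⟨ ∑<-last y term ⟩
  ∑[ j < y ] term j + term y ≡⟨ cong₂ _+_ (∑<-zero y below-top) top ⟩
  1                          ∎
  where
  d = y + sum ys
  term : ℕ → ℕ
  term j = if j <ᵇ suc d then coeff (d ∸ j) ys else 0
  below-top : ∀ j → j < y → term j ≡ 0
  below-top j j<y = trans (if-<ᵇ-true _ (≤-trans j<y (≤-trans (m≤m+n y (sum ys)) (n≤1+n d))))
    (coeff-above-degree ys (d ∸ j) (m+n<o⇒n<o∸m j (sum ys) d (+-monoˡ-< (sum ys) j<y)))
  top : term y ≡ 1
  top = trans (if-<ᵇ-true _ (s≤s (m≤m+n y (sum ys))))
              (trans (cong (λ k → coeff k ys) (m+n∸m≡n y (sum ys))) (coeff-at-degree ys))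

∑-coeff : ∀ r M → sum r < M → ∑[ m < M ] coeff m r ≡ product (map suc r)
∑-coeff []       (suc M) _     = cong suc (∑<-zero M (λ _ _ → refl))
∑-coeff (y ∷ ys) M       y+s<M = begin
  ∑[ m < M ] ∑[ j < suc y ] term m j ≡⟨ ∑<-comm M (suc y) term ⟩
  ∑[ j < suc y ] ∑[ m < M ] term m j ≡⟨ ∑<-cong (suc y) column ⟩
  ∑[ _ < suc y ] product (map suc ys) ≡⟨ ∑<-const (suc y) _ ⟩
  product (map suc (y ∷ ys))         ∎
  where
  term : ℕ → ℕ → ℕ
  term m j = if j <ᵇ suc m then coeff (m ∸ j) ys else 0
  column : ∀ j → j < suc y → ∑[ m < M ] term m j ≡ product (map suc ys)
  column j j≤y = trans (∑<-shift M j (λ m → coeff m ys)) (∑-coeff ys (M ∸ j)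
    (m+n<o⇒n<o∸m j (sum ys) M (≤-<-trans (+-monoˡ-≤ (sum ys) (s≤s⁻¹ j≤y)) y+s<M)))

∑-coeff-below-degree : ∀ r → ∑[ m < sum r ] coeff m r + 1 ≡ product (map suc r)
∑-coeff-below-degree r = begin
  ∑[ m < sum r ] coeff m r + 1
    ≡⟨ cong (∑[ m < sum r ] coeff m r +_) (coeff-at-degree r) ⟨
  ∑[ m < sum r ] coeff m r + coeff (sum r) r
    ≡⟨ ∑<-last (sum r) (λ m → coeff m r) ⟨
  ∑[ m < suc (sum r) ] coeff m r
    ≡⟨ ∑-coeff r (suc (sum r)) ≤-refl ⟩
  product (map suc r) ∎

-- Counting embeddings

subEmb-∷ : ∀ i y xs ys →
  subEmb (suc i ∷ xs) (y ∷ ys) ≡ (if i <ᵇ y then subEmb xs ys else 0) + subEmb (suc i ∷ xs) ys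
subEmb-∷ i y xs ys with suc i ≤? y
... | yes i<y = cong (_+ subEmb (suc i ∷ xs) ys) (sym (if-<ᵇ-true _ i<y))
... | no  i≮y = cong (_+ subEmb (suc i ∷ xs) ys) (sym (if-<ᵇ-false _ i≮y))

∑-subEmb-compositions : ∀ r m → ∑[ q ∈ compositions m ] subEmb q r ≡ coeff m r
∑-subEmb-compositions r        zero    = sym (coeff-0 r)
∑-subEmb-compositions []       (suc n) = trans (∑-compositions-suc n (λ q → subEmb q []))
  (∑<-zero (suc n) (λ i _ → ∑∈-zero (compositions (n ∸ i))))
∑-subEmb-compositions (y ∷ ys) (suc n) = begin
  ∑[ q ∈ compositions (suc n) ] subEmb q (y ∷ ys)
    ≡⟨ ∑-compositions-suc n (λ q → subEmb q (y ∷ ys)) ⟩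
  ∑[ i < suc n ] ∑[ xs ∈ C i ] subEmb (suc i ∷ xs) (y ∷ ys)
    ≡⟨ ∑<-cong (suc n) (λ i _ → split i) ⟩
  ∑[ i < suc n ] (used i + unused i)
    ≡⟨ ∑<-distrib-+ (suc n) used unused ⟩
  ∑< (suc n) used + ∑< (suc n) unused
    ≡⟨ cong₂ _+_ (∑<-if-<ᵇ-comm (suc n) y (λ i → coeff (n ∸ i) ys))
                 (trans (sym (∑-compositions-suc n (λ q → subEmb q ys)))
                        (∑-subEmb-compositions ys (suc n))) ⟩
  ∑[ i < y ] (if i <ᵇ suc n then coeff (n ∸ i) ys else 0) + coeff (suc n) ys
    ≡⟨ +-comm _ (coeff (suc n) ys) ⟩
  coeff (suc n) (y ∷ ys) ∎
  where
  C : ℕ → List (List ℕ)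
  C i = compositions (n ∸ i)
  used unused : ℕ → ℕ
  used   i = if i <ᵇ y then coeff (n ∸ i) ys else 0
  unused i = ∑[ xs ∈ C i ] subEmb (suc i ∷ xs) ys
  split : ∀ i → ∑[ xs ∈ C i ] subEmb (suc i ∷ xs) (y ∷ ys) ≡ used i + unused i
  split i = begin
    ∑[ xs ∈ C i ] subEmb (suc i ∷ xs) (y ∷ ys)
      ≡⟨ ∑∈-cong (C i) (λ xs → subEmb-∷ i y xs ys) ⟩
    ∑[ xs ∈ C i ] ((if i <ᵇ y then subEmb xs ys else 0) + subEmb (suc i ∷ xs) ys)
      ≡⟨ ∑∈-distrib-+ (λ xs → if i <ᵇ y then subEmb xs ys else 0) _ (C i) ⟩
    ∑[ xs ∈ C i ] (if i <ᵇ y then subEmb xs ys else 0) + unused i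
      ≡⟨ cong (_+ unused i) (∑∈-if (i <ᵇ y) (λ xs → subEmb xs ys) (C i)) ⟩
    (if i <ᵇ y then ∑[ xs ∈ C i ] subEmb xs ys else 0) + unused i
      ≡⟨ cong (λ k → (if i <ᵇ y then k else 0) + unused i) (∑-subEmb-compositions ys (n ∸ i)) ⟩
    used i + unused i ∎

∑-nontrivialEmb-compositions : ∀ n r →
  ∑[ q ∈ compositions (suc n) ] nontrivialEmb q r ≡ ∑[ m < suc n ] coeff m r
∑-nontrivialEmb-compositions n r = begin
  ∑[ q ∈ compositions (suc n) ] nontrivialEmb q r
    ≡⟨ ∑-compositions-suc n (λ q → nontrivialEmb q r) ⟩
  ∑[ i < suc n ] ∑[ xs ∈ compositions (n ∸ i) ] subEmb xs r
    ≡⟨ ∑<-cong (suc n) (λ i _ → ∑-subEmb-compositions r (n ∸ i)) ⟩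
  ∑[ i < suc n ] coeff (n ∸ i) r
    ≡⟨ ∑<-reverse n (λ m → coeff m r) ⟩
  ∑[ m < suc n ] coeff m r ∎

trivialEmb-≡ : ∀ {q r} → q ≡ r → trivialEmb q r ≡ 1
trivialEmb-≡ {q} {r} q≡r with ≡-dec _≟_ q r
... | yes _   = refl
... | no  q≢r = ⊥-elim (q≢r q≡r)

trivialEmb-≢ : ∀ {q r} → q ≢ r → trivialEmb q r ≡ 0
trivialEmb-≢ {q} {r} q≢r with ≡-dec _≟_ q r
... | yes q≡r = ⊥-elim (q≢r q≡r)
... | no  _   = refl

trivialEmb-∷ : ∀ x xs ys → trivialEmb (x ∷ xs) (x ∷ ys) ≡ trivialEmb xs ys
trivialEmb-∷ x xs ys = by-cases (≡-dec _≟_ xs ys)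
  where
  by-cases : Dec (xs ≡ ys) → trivialEmb (x ∷ xs) (x ∷ ys) ≡ trivialEmb xs ys
  by-cases (yes xs≡ys) = trans (trivialEmb-≡ (cong (x ∷_) xs≡ys)) (sym (trivialEmb-≡ xs≡ys))
  by-cases (no  xs≢ys) =
    trans (trivialEmb-≢ (xs≢ys ∘ proj₂ ∘ ∷-injective)) (sym (trivialEmb-≢ xs≢ys))

∑-trivialEmb-compositionsFuel : ∀ f n →
  All (λ q → ∑∈ (trivialEmb q) (compositionsFuel f n) ≡ 1) (compositionsFuel f n)
∑-trivialEmb-compositionsFuel f       zero    = refl ∷ []
∑-trivialEmb-compositionsFuel zero    (suc n) = []
∑-trivialEmb-compositionsFuel (suc f) (suc n) = All-compositionsFuel-suc f n
  (λ i i≤n → All.map (once i i≤n) (∑-trivialEmb-compositionsFuel f (n ∸ i)))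
  where
  C : ℕ → List (List ℕ)
  C i = compositionsFuel f (n ∸ i)
  other-first-part : ∀ {i j qs xs} → j ≢ i → trivialEmb (suc i ∷ qs) (suc j ∷ xs) ≡ 0
  other-first-part j≢i = trivialEmb-≢ (j≢i ∘ sym ∘ suc-injective ∘ proj₁ ∘ ∷-injective)
  once : ∀ i → i ≤ n → ∀ {qs} → ∑∈ (trivialEmb qs) (C i) ≡ 1 →
         ∑∈ (trivialEmb (suc i ∷ qs)) (compositionsFuel (suc f) (suc n)) ≡ 1
  once i i≤n {qs} ∑≡1 = begin
    ∑∈ (trivialEmb (suc i ∷ qs)) (compositionsFuel (suc f) (suc n))
      ≡⟨ ∑-compositionsFuel-suc f n (trivialEmb (suc i ∷ qs)) ⟩
    ∑[ j < suc n ] ∑[ xs ∈ C j ] trivialEmb (suc i ∷ qs) (suc j ∷ xs)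
      ≡⟨ ∑<-delta (suc n) i (s≤s i≤n) (λ j j≢i →
           trans (∑∈-cong (C j) (λ _ → other-first-part j≢i)) (∑∈-zero (C j))) ⟩
    ∑[ xs ∈ C i ] trivialEmb (suc i ∷ qs) (suc i ∷ xs)
      ≡⟨ ∑∈-cong (C i) (trivialEmb-∷ (suc i) qs) ⟩
    ∑∈ (trivialEmb qs) (C i)
      ≡⟨ ∑≡1 ⟩
    1 ∎

-- The number of cards

∑∏suc : ℕ → ℕ
∑∏suc n = ∑[ r ∈ compositions n ] product (map suc r)

a≡∑∏suc : ∀ b → a b ≡ ∑∏suc b
a≡∑∏suc zero    = refl
a≡∑∏suc (suc n) = begin
  sum (concatMap (λ q → map (entryA q) C) C)
    ≡⟨ sum-concatMap (λ q → map (entryA q) C) C ⟩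
  ∑[ q ∈ C ] ∑[ r ∈ C ] (nontrivialEmb q r + trivialEmb q r)
    ≡⟨ ∑∈-cong C (λ q → ∑∈-distrib-+ (nontrivialEmb q) (trivialEmb q) C) ⟩
  ∑[ q ∈ C ] (∑[ r ∈ C ] nontrivialEmb q r + ∑[ r ∈ C ] trivialEmb q r)
    ≡⟨ ∑∈-distrib-+ (λ q → ∑∈ (nontrivialEmb q) C) (λ q → ∑∈ (trivialEmb q) C) C ⟩
  ∑[ q ∈ C ] ∑[ r ∈ C ] nontrivialEmb q r + ∑[ q ∈ C ] ∑[ r ∈ C ] trivialEmb q r
    ≡⟨ cong₂ _+_ (∑∈-comm nontrivialEmb C C)
                 (∑∈-cong-All (∑-trivialEmb-compositionsFuel (suc n) (suc n))) ⟩
  ∑[ r ∈ C ] ∑[ q ∈ C ] nontrivialEmb q r + ∑[ _ ∈ C ] 1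
    ≡⟨ cong (_+ ∑[ _ ∈ C ] 1) (∑∈-cong C (∑-nontrivialEmb-compositions n)) ⟩
  ∑[ r ∈ C ] ∑[ m < suc n ] coeff m r + ∑[ _ ∈ C ] 1
    ≡⟨ ∑∈-distrib-+ (λ r → ∑[ m < suc n ] coeff m r) (λ _ → 1) C ⟨
  ∑[ r ∈ C ] (∑[ m < suc n ] coeff m r + 1)
    ≡⟨ ∑∈-cong-All (All.map (λ {r} → column {r}) (compositionsFuel-sum (suc n) (suc n))) ⟩
  ∑∏suc (suc n) ∎
  where
  C : List (List ℕ)
  C = compositions (suc n)
  column : ∀ {r} → sum r ≡ suc n → ∑[ m < suc n ] coeff m r + 1 ≡ product (map suc r)
  column {r} sum≡ =
    subst (λ s → ∑[ m < s ] coeff m r + 1 ≡ product (map suc r)) sum≡ (∑-coeff-below-degree r)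

∑∏suc-suc : ∀ n → ∑∏suc (suc n) ≡ ∑[ i < suc n ] ((2 + i) * ∑∏suc (n ∸ i))
∑∏suc-suc n = trans (∑-compositions-suc n (product ∘ map suc)) (∑<-cong (suc n) (λ i _ →
  ∑∈-*ˡ (2 + i) (product ∘ map suc) (compositions (n ∸ i))))

convolution-recurrence : ∀ (u : ℕ → ℕ) →
  (∀ n → u (suc n) ≡ ∑[ i < suc n ] ((2 + i) * u (n ∸ i))) →
  ∀ n → u (3 + n) + 2 * u (1 + n) ≡ 4 * u (2 + n)
convolution-recurrence u u-suc n = begin
  u (3 + n) + 2 * u (1 + n)
    ≡⟨ cong (_+ 2 * u (1 + n)) (step (1 + n)) ⟩
  3 * u (2 + n) + (u (1 + n) + partial n) + 2 * u (1 + n)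
    ≡⟨ cong (λ v → 3 * v + (u (1 + n) + partial n) + 2 * u (1 + n)) (step n) ⟩
  3 * (3 * u (1 + n) + partial n) + (u (1 + n) + partial n) + 2 * u (1 + n)
    ≡⟨ identity (u (1 + n)) (partial n) ⟩
  4 * (3 * u (1 + n) + partial n)
    ≡⟨ cong (4 *_) (step n) ⟨
  4 * u (2 + n) ∎
  where
  partial : ℕ → ℕ
  partial n = ∑[ i < suc n ] u (n ∸ i)
  identity : ∀ x p → 3 * (3 * x + p) + (x + p) + 2 * x ≡ 4 * (3 * x + p)
  identity = solve-∀
  regroup : ∀ x p → 2 * x + (p + x) ≡ 3 * x + p
  regroup = solve-∀
  step : ∀ n → u (2 + n) ≡ 3 * u (1 + n) + partial n
  step n = begin
    u (2 + n)
      ≡⟨ u-suc (suc n) ⟩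
    2 * u (1 + n) + ∑[ i < suc n ] (u (n ∸ i) + (2 + i) * u (n ∸ i))
      ≡⟨ cong (2 * u (1 + n) +_)
              (∑<-distrib-+ (suc n) (u ∘ (n ∸_)) (λ i → (2 + i) * u (n ∸ i))) ⟩
    2 * u (1 + n) + (partial n + ∑[ i < suc n ] ((2 + i) * u (n ∸ i)))
      ≡⟨ cong (λ v → 2 * u (1 + n) + (partial n + v)) (u-suc n) ⟨
    2 * u (1 + n) + (partial n + u (1 + n))
      ≡⟨ regroup (u (1 + n)) (partial n) ⟩
    3 * u (1 + n) + partial n ∎

theorem4 : ∀ (b : ℕ) → b ≥ 3 → a b + 2 * a (b ∸ 2) ≡ 4 * a (b ∸ 1)
theorem4 1 (s≤s ())
theorem4 2 (s≤s (s≤s ()))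
theorem4 (suc (suc (suc n))) _ = begin
  a (3 + n) + 2 * a (1 + n)
    ≡⟨ cong₂ (λ x y → x + 2 * y) (a≡∑∏suc (3 + n)) (a≡∑∏suc (1 + n)) ⟩
  ∑∏suc (3 + n) + 2 * ∑∏suc (1 + n)
    ≡⟨ convolution-recurrence ∑∏suc ∑∏suc-suc n ⟩
  4 * ∑∏suc (2 + n)
    ≡⟨ cong (4 *_) (a≡∑∏suc (2 + n)) ⟨
  4 * a (2 + n) ∎
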